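{- Let $k\ge2$ and $n>2^k$ be integers, $c=2^k-2$, suppose $d=\gcd(c,n-1)>1$, let $w=(n-1)/d$, and define $y$ on $V=\{0,\dots,n-1\}$ by $y_v=0$ if $v$ is a multiple of $d$ and $y_v=\frac{1}{w(d-1)}$ otherwise. Then for any $v\in V$ and any integer $\ell\le n-1$, $$y([v\oplus\ell]_{n-1})=\frac{\ell-\lfloor \ell/d\rfloor}{w(d-1)}\quad\text{or}\quad y([v\oplus\ell]_{n-1})=\frac{\ell-\lceil \ell/d\rceil}{w(d-1)}.$$
   Context: Interval notation: for integers $u,v$ and $r\ge1$, $[u,v]_r=\{z\bmod r:u\le z\le v\}$ if $u\le v$ and $\emptyset$ otherwise, and $[v\oplus\ell]_r=[v,v+\ell-1]_r$. For $S\subseteq V$, $y(S)=\sum_{v\in S}y_v$. -}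

module Defs where

open import Data.Bool using (Bool; true; false; if_then_else_)
open import Data.Nat as ℕ using (ℕ; zero; suc; _≡ᵇ_)
open import Data.Nat.Divisibility using (_∣?_)
open import Data.Integer as ℤ using (ℤ; +_)
open import Data.List using (List; map; upTo; foldr)
open import Data.Bool.ListAction using (any)
open import Data.Rational using (ℚ; _/_; 0ℚ; _+_; _*_)
open import Relation.Nullary.Decidable using (does)

-- the rational number z / m  (m ≠ 0 in all uses; the m = 0 branch is never used)
_÷ℕ_ : ℤ → ℕ → ℚ
z ÷ℕ zero  = 0ℚ
z ÷ℕ suc m = z / suc m

-- natural-number quotient / remainder (divisor ≠ 0 in all uses)
divℕ : ℕ → ℕ → ℕ
divℕ m zero    = 0
divℕ m (suc r) = m ℕ./ suc r

modℕ : ℕ → ℕ → ℕ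
modℕ m zero    = m
modℕ m (suc r) = m ℕ.% suc r

-- membership of u in [v ⊕ ℓ]_r = { z mod r : v ≤ z ≤ v + ℓ - 1 }
inSeg : (r v ℓ u : ℕ) → Bool
inSeg r v ℓ u = any (λ z → modℕ z r ≡ᵇ u) (map (v ℕ.+_) (upTo ℓ))

ySum : (n : ℕ) → (ℕ → ℚ) → (ℕ → Bool) → ℚ
ySum n y S = foldr (λ u acc → (if S u then y u else 0ℚ) + acc) 0ℚ (upTo n)

yFun : (d w : ℕ) → ℕ → ℚ
yFun d w v = if does (d ∣? v) then 0ℚ else (+ 1) ÷ℕ (w ℕ.* (d ℕ.∸ 1))

-- For ℓ ≤ n − 1 the set [v ⊕ ℓ]_{n−1} consists of the residues of the ℓ consecutive
-- integers v, …, v + ℓ − 1, which are pairwise distinct, and since d ∣ n − 1 a residue is a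
-- multiple of d exactly when the integer is. So y([v ⊕ ℓ]) is 1/(w(d−1)) times the number of
-- non-multiples of d in a window of ℓ consecutive integers. Sliding a window of length d does
-- not change its number of multiples, because divisibility by d is d-periodic, so every such
-- window contains exactly one. Splitting ℓ = (ℓ mod d) + ⌊ℓ/d⌋·d, a window of length ℓ then
-- contains ⌊ℓ/d⌋ multiples plus at most one more, and one more only if d ∤ ℓ, in which case
-- ⌈ℓ/d⌉ = ⌊ℓ/d⌋ + 1.
module Submission where

open import Defs
open import Data.Nat using (ℕ; _≤_; _<_; _^_; _∸_; _*_)
open import Data.Nat.GCD using (gcd)
open import Data.Integer using (+_; _-_)
open import Data.Rational using (floor; ceiling)
open import Data.Sum using (_⊎_)
open import Relation.Binary.PropositionalEquality using (_≡_)

open import Level using (Level)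
open import Function using (_∘_)
open import Function.Bundles using (Equivalence; mk⇔)
open import Data.Bool using (Bool; true; false; not; _∧_; _∨_; if_then_else_)
open import Data.Bool.Properties using (∧-distribʳ-∨; T-≡; T-∧)
open import Data.Bool.ListAction using (any; or)
open import Data.List using (List; []; _∷_; [_]; _++_; length; map; upTo; applyUpTo; foldr)
open import Data.List.Properties using (upTo-∷ʳ; map-upTo; map-applyUpTo; length-upTo)
open import Data.List.Relation.Unary.All using (All; []; _∷_)
import Data.List.Relation.Unary.All.Properties as All
open import Data.List.Relation.Unary.AllPairs using ([]; _∷_)
open import Data.List.Relation.Unary.Unique.Propositional using (Unique)
import Data.List.Relation.Unary.Unique.Propositional.Properties as Unique
open import Data.Nat as ℕ using (zero; suc; _+_; z≤n; s≤s; NonZero; _≡ᵇ_)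
import Data.Nat.Properties as ℕ
open import Data.Nat.DivMod
  using (_/_; _%_; m≡m%n+[m/n]*n; m%n<n; m%n≤n; %-congˡ; m/n/o≡m/[n*o]; /-congʳ; m*[n/m]≡n; m/n*n≡m)
open import Data.Nat.Divisibility
  using ( _∣_; _∣?_; ∣m+n∣m⇒∣n; ∣m∣n⇒∣m+n; ∣-refl; n∣m*n; ∣⇒≤; n∣m⇒m%n≡0; m%n≡0⇒n∣m; ∣n∣m%n⇒∣m
        ; %-presˡ-∣; *-monoˡ-∣)
open import Data.Nat.GCD using (gcd[m,n]∣m; gcd[m,n]∣n; gcd[m,n]≢0; n/gcd[m,n]≢0)
open import Data.Nat.Coprimality using (Coprime)
import Data.Integer as ℤ
import Data.Integer.Properties as ℤ
open import Data.Rational as ℚ using (0ℚ; toℚᵘ; fromℚᵘ)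
open import Data.Rational.Properties as ℚ using (fromℚᵘ-cong; fromℚᵘ-toℚᵘ; toℚᵘ-fromℚᵘ; toℚᵘ-homo-+)
import Data.Rational.Unnormalised as ℚᵘ
import Data.Rational.Unnormalised.Properties as ℚᵘ
open import Data.Product using (_×_; _,_; proj₁)
open import Data.Sum as Sum using (inj₁; inj₂)
open import Relation.Nullary using (¬_; contradiction)
open import Relation.Nullary.Decidable using (does; yes; no; dec-true; dec-false; does-⇔)
open import Relation.Binary.PropositionalEquality
  using (_≢_; refl; sym; trans; cong; cong₂; subst; subst₂; _≗_; ≢-sym; module ≡-Reasoning)

private
  variable
    a : Level
    A : Set a

countᵇ : (A → Bool) → List A → ℕ
countᵇ p []       = 0
countᵇ p (x ∷ xs) = if p x then suc (countᵇ p xs) else countᵇ p xs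

module _ (p : A → Bool) where

  countᵇ-++ : ∀ xs ys → countᵇ p (xs ++ ys) ≡ countᵇ p xs + countᵇ p ys
  countᵇ-++ []       ys = refl
  countᵇ-++ (x ∷ xs) ys with p x
  ... | true  = cong suc (countᵇ-++ xs ys)
  ... | false = countᵇ-++ xs ys

  countᵇ-not : ∀ xs → countᵇ (not ∘ p) xs + countᵇ p xs ≡ length xs
  countᵇ-not [] = refl
  countᵇ-not (x ∷ xs) with p x
  ... | true  = trans (ℕ.+-suc _ _) (cong suc (countᵇ-not xs))
  ... | false = cong suc (countᵇ-not xs)

  countᵇ-none : ∀ {xs} → All (λ x → p x ≡ false) xs → countᵇ p xs ≡ 0
  countᵇ-none []                = refl
  countᵇ-none (px≡false ∷ rest) rewrite px≡false = countᵇ-none rest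

  countᵇ-map : ∀ {b} {B : Set b} (f : B → A) xs → countᵇ p (map f xs) ≡ countᵇ (p ∘ f) xs
  countᵇ-map f [] = refl
  countᵇ-map f (x ∷ xs) with p (f x)
  ... | true  = cong suc (countᵇ-map f xs)
  ... | false = countᵇ-map f xs

countᵇ-cong : ∀ {p q : A → Bool} → p ≗ q → countᵇ p ≗ countᵇ q
countᵇ-cong p≗q [] = refl
countᵇ-cong {p = p} {q} p≗q (x ∷ xs) with p x | q x | p≗q x
... | true  | true  | _ = cong suc (countᵇ-cong p≗q xs)
... | false | false | _ = countᵇ-cong p≗q xs

countᵇ-∨ : ∀ (p q : A → Bool) → (∀ x → p x ≡ true → q x ≡ false) →
           ∀ xs → countᵇ (λ x → p x ∨ q x) xs ≡ countᵇ p xs + countᵇ q xs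
countᵇ-∨ p q disjoint [] = refl
countᵇ-∨ p q disjoint (x ∷ xs) with p x in px | q x in qx
... | true  | true  = contradiction (trans (sym qx) (disjoint x px)) λ ()
... | true  | false = cong suc (countᵇ-∨ p q disjoint xs)
... | false | true  = trans (cong suc (countᵇ-∨ p q disjoint xs)) (sym (ℕ.+-suc _ _))
... | false | false = countᵇ-∨ p q disjoint xs

countᵇ-upTo-suc : ∀ (p : ℕ → Bool) n → countᵇ p (upTo (suc n)) ≡ countᵇ p (upTo n) + countᵇ p [ n ]
countᵇ-upTo-suc p n = trans (cong (countᵇ p) (sym (upTo-∷ʳ n))) (countᵇ-++ p (upTo n) [ n ])

countᵇ-point : ∀ (p : ℕ → Bool) {x n} → x < n →
               countᵇ (λ u → (x ≡ᵇ u) ∧ p u) (upTo n) ≡ countᵇ p [ x ]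
countᵇ-point p {x} {suc n} x<1+n with x ℕ.≟ n
... | yes refl = trans (countᵇ-upTo-suc q x) (cong₂ _+_ (countᵇ-none q others) self)
  where
  q = λ u → (x ≡ᵇ u) ∧ p u
  others : All (λ u → q u ≡ false) (upTo x)
  others = All.applyUpTo⁺₁ (λ u → u) x (λ {u} u<x → cong (_∧ p u) (dec-false (x ℕ.≟ u) (ℕ.>⇒≢ u<x)))
  self : countᵇ q [ x ] ≡ countᵇ p [ x ]
  self rewrite dec-true (x ℕ.≟ x) refl = refl
... | no x≢n = trans (countᵇ-upTo-suc _ n) (trans (cong₂ _+_ (countᵇ-point p x<n) last) (ℕ.+-identityʳ _))
  where
  x<n : x < n
  x<n = ℕ.≤∧≢⇒< (ℕ.≤-pred x<1+n) x≢n
  last : countᵇ (λ u → (x ≡ᵇ u) ∧ p u) [ n ] ≡ 0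
  last rewrite dec-false (x ℕ.≟ n) x≢n = refl

any-≡ᵇ-false : ∀ {x xs} → All (x ≢_) xs → any (_≡ᵇ x) xs ≡ false
any-≡ᵇ-false []             = refl
any-≡ᵇ-false (x≢y ∷ x≢rest) = cong₂ _∨_ (dec-false (_ ℕ.≟ _) (≢-sym x≢y)) (any-≡ᵇ-false x≢rest)

countᵇ-upTo-∈ : ∀ (p : ℕ → Bool) {n xs} → Unique xs → All (_< n) xs →
                countᵇ (λ u → any (_≡ᵇ u) xs ∧ p u) (upTo n) ≡ countᵇ p xs
countᵇ-upTo-∈ p {n} []                  []           = countᵇ-none _ (All.applyUpTo⁺₂ (λ u → u) n (λ _ → refl))
countᵇ-upTo-∈ p {n} {x ∷ xs} (x∉xs ∷ xs-unique) (x<n ∷ xs<n) = begin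
  countᵇ (λ u → ((x ≡ᵇ u) ∨ any (_≡ᵇ u) xs) ∧ p u) (upTo n)
    ≡⟨ countᵇ-cong (λ u → ∧-distribʳ-∨ (p u) (x ≡ᵇ u) (any (_≡ᵇ u) xs)) (upTo n) ⟩
  countᵇ (λ u → ((x ≡ᵇ u) ∧ p u) ∨ (any (_≡ᵇ u) xs ∧ p u)) (upTo n)
    ≡⟨ countᵇ-∨ _ _ disjoint (upTo n) ⟩
  countᵇ (λ u → (x ≡ᵇ u) ∧ p u) (upTo n) + countᵇ (λ u → any (_≡ᵇ u) xs ∧ p u) (upTo n)
    ≡⟨ cong₂ _+_ (countᵇ-point p x<n) (countᵇ-upTo-∈ p xs-unique xs<n) ⟩
  countᵇ p [ x ] + countᵇ p xs
    ≡⟨ countᵇ-++ p [ x ] xs ⟨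
  countᵇ p (x ∷ xs) ∎
  where
  open ≡-Reasoning
  disjoint : ∀ u → (x ≡ᵇ u) ∧ p u ≡ true → any (_≡ᵇ u) xs ∧ p u ≡ false
  disjoint u x≡u∧pu with ℕ.≡ᵇ⇒≡ x u (proj₁ (Equivalence.to T-∧ (Equivalence.from T-≡ x≡u∧pu)))
  ... | refl = cong (_∧ p u) (any-≡ᵇ-false x∉xs)

countᵇ-applyUpTo : ∀ (p : A → Bool) f n → countᵇ p (applyUpTo f n) ≡ countᵇ (p ∘ f) (upTo n)
countᵇ-applyUpTo p f n = trans (cong (countᵇ p) (sym (map-upTo f n))) (countᵇ-map p f (upTo n))

applyUpTo-+ : ∀ (f : ℕ → A) m n → applyUpTo f (m + n) ≡ applyUpTo f m ++ applyUpTo (λ i → f (m + i)) n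
applyUpTo-+ f zero    n = refl
applyUpTo-+ f (suc m) n = cong (f 0 ∷_) (applyUpTo-+ (f ∘ suc) m n)

countWindow : (ℕ → Bool) → ℕ → ℕ → ℕ
countWindow p v ℓ = countᵇ (λ i → p (v + i)) (upTo ℓ)

module _ (p : ℕ → Bool) where

  countWindow-+ : ∀ v m n → countWindow p v (m + n) ≡ countWindow p v m + countWindow p (v + m) n
  countWindow-+ v m n = begin
    countᵇ q (upTo (m + n))                             ≡⟨ cong (countᵇ q) (applyUpTo-+ (λ i → i) m n) ⟩
    countᵇ q (upTo m ++ applyUpTo (m ℕ.+_) n)           ≡⟨ countᵇ-++ q (upTo m) _ ⟩
    countWindow p v m + countᵇ q (applyUpTo (m ℕ.+_) n) ≡⟨ cong (countWindow p v m ℕ.+_) shift ⟩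
    countWindow p v m + countWindow p (v + m) n         ∎
    where
    open ≡-Reasoning
    q = λ i → p (v + i)
    shift : countᵇ q (applyUpTo (m ℕ.+_) n) ≡ countWindow p (v + m) n
    shift = trans (countᵇ-applyUpTo q (m ℕ.+_) n) (countᵇ-cong (λ i → cong p (sym (ℕ.+-assoc v m i))) (upTo n))

  countWindow-mono : ∀ v {m n} → m ≤ n → countWindow p v m ≤ countWindow p v n
  countWindow-mono v {m} {n} m≤n = subst (countWindow p v m ≤_)
    (trans (sym (countWindow-+ v m (n ∸ m))) (cong (countWindow p v) (ℕ.m+[n∸m]≡n m≤n)))
    (ℕ.m≤m+n _ _)

  module _ {d} (periodic : ∀ z → p (z + d) ≡ p z) where

    countWindow-slide : ∀ v → countWindow p (suc v) d ≡ countWindow p v d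
    countWindow-slide v = ℕ.+-cancelˡ-≡ (countWindow p v 1) _ _ (begin
      countWindow p v 1 + countWindow p (suc v) d   ≡⟨ cong (λ x → countWindow p v 1 + countWindow p x d) 1+v≡v+1 ⟩
      countWindow p v 1 + countWindow p (v + 1) d   ≡⟨ countWindow-+ v 1 d ⟨
      countWindow p v (1 + d)                       ≡⟨ cong (countWindow p v) (ℕ.+-comm 1 d) ⟩
      countWindow p v (d + 1)                       ≡⟨ countWindow-+ v d 1 ⟩
      countWindow p v d + countWindow p (v + d) 1   ≡⟨ cong (countWindow p v d ℕ.+_) (countᵇ-cong shift (upTo 1)) ⟩
      countWindow p v d + countWindow p v 1         ≡⟨ ℕ.+-comm (countWindow p v d) _ ⟩
      countWindow p v 1 + countWindow p v d         ∎)
      where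
      open ≡-Reasoning
      1+v≡v+1 : suc v ≡ v + 1
      1+v≡v+1 = ℕ.+-comm 1 v
      shift : ∀ i → p (v + d + i) ≡ p (v + i)
      shift i = trans (cong p v+d+i≡v+i+d) (periodic (v + i))
        where
        v+d+i≡v+i+d : v + d + i ≡ v + i + d
        v+d+i≡v+i+d = trans (ℕ.+-assoc v d i) (trans (cong (v ℕ.+_) (ℕ.+-comm d i)) (sym (ℕ.+-assoc v i d)))

    countWindow-periodic : ∀ v → countWindow p v d ≡ countWindow p 0 d
    countWindow-periodic zero    = refl
    countWindow-periodic (suc v) = trans (countWindow-slide v) (countWindow-periodic v)

    countWindow-periods : ∀ v q → countWindow p v (q * d) ≡ q * countWindow p 0 d
    countWindow-periods v zero    = refl
    countWindow-periods v (suc q) = begin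
      countWindow p v (d + q * d)
        ≡⟨ countWindow-+ v d (q * d) ⟩
      countWindow p v d + countWindow p (v + d) (q * d)
        ≡⟨ cong₂ _+_ (countWindow-periodic v) (countWindow-periods (v + d) q) ⟩
      countWindow p 0 d + q * countWindow p 0 d ∎
      where open ≡-Reasoning

infix 4 _∣ᵇ_
_∣ᵇ_ : ℕ → ℕ → Bool
d ∣ᵇ z = does (d ∣? z)

∣ᵇ-periodic : ∀ d z → (d ∣ᵇ z + d) ≡ (d ∣ᵇ z)
∣ᵇ-periodic d z = does-⇔ (mk⇔ (λ d∣z+d → ∣m+n∣m⇒∣n (subst (d ∣_) (ℕ.+-comm z d) d∣z+d) ∣-refl)
                              (λ d∣z → ∣m∣n⇒∣m+n d∣z ∣-refl))
                         (d ∣? z + d) (d ∣? z)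

countWindow-∣ᵇ-period : ∀ d .{{_ : NonZero d}} → countWindow (d ∣ᵇ_) 0 d ≡ 1
countWindow-∣ᵇ-period (suc d) = trans (countWindow-+ (suc d ∣ᵇ_) 0 1 d) (cong suc (countᵇ-none _ none))
  where
  none : All (λ i → (suc d ∣ᵇ 1 + i) ≡ false) (upTo d)
  none = All.applyUpTo⁺₁ (λ i → i) d λ {i} i<d →
    dec-false (suc d ∣? 1 + i) (λ d∣1+i → ℕ.<⇒≱ (s≤s i<d) (∣⇒≤ d∣1+i))

countWindow-∣ᵇ : ∀ d .{{_ : NonZero d}} v ℓ →
                 countWindow (d ∣ᵇ_) v ℓ ≡ ℓ / d ⊎ (¬ d ∣ ℓ × countWindow (d ∣ᵇ_) v ℓ ≡ suc (ℓ / d))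
countWindow-∣ᵇ d v ℓ = classify (countWindow p v s) refl head≤1
  where
  p = d ∣ᵇ_
  s = ℓ % d
  q = ℓ / d
  period : countWindow p 0 d ≡ 1
  period = countWindow-∣ᵇ-period d
  split : countWindow p v ℓ ≡ countWindow p v s + q
  split = begin
    countWindow p v ℓ
      ≡⟨ cong (countWindow p v) (m≡m%n+[m/n]*n ℓ d) ⟩
    countWindow p v (s + q * d)
      ≡⟨ countWindow-+ p v s (q * d) ⟩
    countWindow p v s + countWindow p (v + s) (q * d)
      ≡⟨ cong (countWindow p v s ℕ.+_) (countWindow-periods p (∣ᵇ-periodic d) (v + s) q) ⟩
    countWindow p v s + q * countWindow p 0 d
      ≡⟨ cong (λ c → countWindow p v s + q * c) period ⟩
    countWindow p v s + q * 1
      ≡⟨ cong (countWindow p v s ℕ.+_) (ℕ.*-identityʳ q) ⟩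
    countWindow p v s + q ∎
    where open ≡-Reasoning
  head≤1 : countWindow p v s ≤ 1
  head≤1 = ℕ.≤-trans (countWindow-mono p v (m%n≤n ℓ d))
                     (ℕ.≤-reflexive (trans (countWindow-periodic p (∣ᵇ-periodic d) v) period))
  classify : ∀ h → countWindow p v s ≡ h → h ≤ 1 →
             countWindow p v ℓ ≡ q ⊎ (¬ d ∣ ℓ × countWindow p v ℓ ≡ suc q)
  classify 0             head _ = inj₁ (trans split (cong (_+ q) head))
  classify 1             head _ = inj₂ (d∤ℓ , trans split (cong (_+ q) head))
    where
    d∤ℓ : ¬ d ∣ ℓ
    d∤ℓ d∣ℓ with () ← trans (cong (countWindow p v) (sym (n∣m⇒m%n≡0 ℓ d d∣ℓ))) head
  classify (suc (suc _)) _    (s≤s ())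

[m+k]%n≢m%n : ∀ m {k n} .{{_ : NonZero n}} → 0 < k → k < n → (m + k) % n ≢ m % n
[m+k]%n≢m%n m {k} {n} 0<k k<n eq = ℕ.<⇒≱ k<n (∣⇒≤ {{ℕ.>-nonZero 0<k}} n∣k)
  where
  quotients : m / n * n + k ≡ (m + k) / n * n
  quotients = ℕ.+-cancelˡ-≡ (m % n) _ _ (begin
    m % n + (m / n * n + k)         ≡⟨ ℕ.+-assoc (m % n) _ k ⟨
    m % n + m / n * n + k           ≡⟨ cong (_+ k) (m≡m%n+[m/n]*n m n) ⟨
    m + k                           ≡⟨ m≡m%n+[m/n]*n (m + k) n ⟩
    (m + k) % n + (m + k) / n * n   ≡⟨ cong (_+ (m + k) / n * n) eq ⟩
    m % n + (m + k) / n * n         ∎)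
    where open ≡-Reasoning
  n∣k : n ∣ k
  n∣k = ∣m+n∣m⇒∣n (subst (n ∣_) (sym quotients) (n∣m*n ((m + k) / n))) (n∣m*n (m / n))

segment : ℕ → ℕ → ℕ → List ℕ
segment r v ℓ = applyUpTo (λ i → modℕ (v + i) r) ℓ

inSeg-segment : ∀ r v ℓ u → inSeg r v ℓ u ≡ any (_≡ᵇ u) (segment r v ℓ)
inSeg-segment r v ℓ u = cong or (trans (cong (map _) (map-upTo (v ℕ.+_) ℓ))
  (trans (map-applyUpTo (v ℕ.+_) (λ z → modℕ z r ≡ᵇ u) ℓ)
         (sym (map-applyUpTo (λ i → modℕ (v + i) r) (_≡ᵇ u) ℓ))))

modℕ-distinct : ∀ r m {i j} → i < j → j < r → modℕ (m + i) r ≢ modℕ (m + j) r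
modℕ-distinct (suc r) m {i} {j} i<j j<r eq =
  [m+k]%n≢m%n (m + i) (ℕ.m<n⇒0<n∸m i<j) (ℕ.≤-<-trans (ℕ.m∸n≤m j i) j<r)
              (trans (%-congˡ m+i+[j∸i]≡m+j) (sym eq))
  where
  m+i+[j∸i]≡m+j : m + i + (j ∸ i) ≡ m + j
  m+i+[j∸i]≡m+j = trans (ℕ.+-assoc m i (j ∸ i)) (cong (m ℕ.+_) (ℕ.m+[n∸m]≡n (ℕ.<⇒≤ i<j)))

segment-unique : ∀ r v {ℓ} → ℓ ≤ r → Unique (segment r v ℓ)
segment-unique r v {ℓ} ℓ≤r =
  Unique.applyUpTo⁺₁ _ ℓ (λ i<j j<ℓ → modℕ-distinct r v i<j (ℕ.<-≤-trans j<ℓ ℓ≤r))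

modℕ-< : ∀ m {r} → 0 < r → modℕ m r < r
modℕ-< m {suc r} _ = m%n<n m (suc r)

segment-< : ∀ r v ℓ → ℓ ≤ r → All (_< suc r) (segment r v ℓ)
segment-< r v ℓ ℓ≤r =
  All.applyUpTo⁺₁ _ ℓ (λ i<ℓ → ℕ.m<n⇒m<1+n (modℕ-< _ (ℕ.≤-<-trans z≤n (ℕ.<-≤-trans i<ℓ ℓ≤r))))

countᵇ-inSeg : ∀ (p : ℕ → Bool) r v ℓ → ℓ ≤ r →
               countᵇ (λ u → inSeg r v ℓ u ∧ p u) (upTo (suc r)) ≡ countWindow (λ z → p (modℕ z r)) v ℓ
countᵇ-inSeg p r v ℓ ℓ≤r = begin
  countᵇ (λ u → inSeg r v ℓ u ∧ p u) (upTo (suc r))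
    ≡⟨ countᵇ-cong (λ u → cong (_∧ p u) (inSeg-segment r v ℓ u)) (upTo (suc r)) ⟩
  countᵇ (λ u → any (_≡ᵇ u) (segment r v ℓ) ∧ p u) (upTo (suc r))
    ≡⟨ countᵇ-upTo-∈ p (segment-unique r v ℓ≤r) (segment-< r v ℓ ℓ≤r) ⟩
  countᵇ p (segment r v ℓ)
    ≡⟨ countᵇ-applyUpTo p _ ℓ ⟩
  countWindow (λ z → p (modℕ z r)) v ℓ ∎
  where open ≡-Reasoning

∣ᵇ-modℕ : ∀ d r m → d ∣ r → (d ∣ᵇ modℕ m r) ≡ (d ∣ᵇ m)
∣ᵇ-modℕ d zero    m _   = refl
∣ᵇ-modℕ d (suc r) m d∣r = does-⇔ (mk⇔ (∣n∣m%n⇒∣m d∣r) (λ d∣m → %-presˡ-∣ d∣m d∣r)) (d ∣? _) (d ∣? m)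

÷ℕ-homo-+ : ∀ a b Q → (+ (a + b)) ÷ℕ Q ≡ (+ a) ÷ℕ Q ℚ.+ (+ b) ÷ℕ Q
÷ℕ-homo-+ a b zero = sym (ℚ.+-identityˡ 0ℚ)
÷ℕ-homo-+ a b Q@(suc _) = trans (fromℚᵘ-cong sum≃) (fromℚᵘ-toℚᵘ (x ℚ.+ y))
  where
  x = (+ a) ℚ./ Q
  y = (+ b) ℚ./ Q
  numerator : + a ℤ.* + Q ℤ.+ + b ℤ.* + Q ≡ + (a + b) ℤ.* + Q
  numerator = trans (sym (ℤ.*-distribʳ-+ (+ Q) (+ a) (+ b))) (cong (ℤ._* + Q) (sym (ℤ.pos-+ a b)))
  sum≃ : + (a + b) ℚᵘ./ Q ℚᵘ.≃ toℚᵘ (x ℚ.+ y)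
  sum≃ = begin
    + (a + b) ℚᵘ./ Q
      ≈⟨ ℚᵘ.*-cancelʳ-/ Q ⟨
    (+ (a + b) ℤ.* + Q) ℚᵘ./ (Q * Q)
      ≈⟨ ℚᵘ.≃-reflexive (cong (ℚᵘ._/ (Q * Q)) numerator) ⟨
    (+ a ℚᵘ./ Q) ℚᵘ.+ (+ b ℚᵘ./ Q)
      ≈⟨ ℚᵘ.+-cong (toℚᵘ-fromℚᵘ (+ a ℚᵘ./ Q)) (toℚᵘ-fromℚᵘ (+ b ℚᵘ./ Q)) ⟨
    toℚᵘ x ℚᵘ.+ toℚᵘ y
      ≈⟨ toℚᵘ-homo-+ x y ⟨
    toℚᵘ (x ℚ.+ y) ∎
    where open ℚᵘ.≃-Reasoning

floor-mkℚ+ : ∀ m n .{{_ : NonZero n}} .{m⊥n : Coprime m n} → floor (ℚ.mkℚ+ m n m⊥n) ≡ + (m / n)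
floor-mkℚ+ m (suc n) = ℤ.*-identityˡ _

-- ceiling p is - floor (- p), and ℤ division rounds the negative numerator down past
-- -⌊m/n⌋ exactly when the remainder is nonzero.
ceiling-mkℚ+ : ∀ m n .{{_ : NonZero n}} .{m⊥n : Coprime m n} → m % n ≢ 0 →
               ceiling (ℚ.mkℚ+ m n m⊥n) ≡ + suc (m / n)
ceiling-mkℚ+ zero    (suc n) m%n≢0 = contradiction refl m%n≢0
ceiling-mkℚ+ (suc m) (suc n) m%n≢0 with suc m % suc n
... | zero  = contradiction refl m%n≢0
... | suc _ = cong (λ q → + suc q) (ℕ.+-identityʳ _)

m/o/[n/o]≡m/n : ∀ m n o .{{_ : NonZero n}} .{{_ : NonZero o}} .{{_ : NonZero (n / o)}} → o ∣ n →
                (m / o) / (n / o) ≡ m / n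
m/o/[n/o]≡m/n m n o o∣n = trans (m/n/o≡m/[n*o] m o (n / o)) (/-congʳ (m*[n/m]≡n o∣n))
  where
  instance
    o*[n/o]≢0 : NonZero (o ℕ.* (n / o))
    o*[n/o]≢0 = ℕ.≢-nonZero (subst (_≢ 0) (sym (m*[n/m]≡n o∣n)) (ℕ.≢-nonZero⁻¹ n))

module _ (m n : ℕ) .{{_ : NonZero n}} where
  private
    g = gcd m n
    instance
      g≢0 : NonZero g
      g≢0 = ℕ.≢-nonZero (gcd[m,n]≢0 m n (inj₂ (ℕ.≢-nonZero⁻¹ n)))
      n/g≢0 : NonZero (n / g)
      n/g≢0 = ℕ.≢-nonZero (n/gcd[m,n]≢0 m n)

  floor-/ : floor (+ m ℚ./ n) ≡ + (m / n)
  floor-/ = trans (floor-mkℚ+ (m / g) (n / g)) (cong +_ (m/o/[n/o]≡m/n m n g (gcd[m,n]∣n m n)))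

  ceiling-/ : ¬ n ∣ m → ceiling (+ m ℚ./ n) ≡ + suc (m / n)
  ceiling-/ n∤m = trans (ceiling-mkℚ+ (m / g) (n / g) [m/g]%[n/g]≢0)
                        (cong (λ q → + suc q) (m/o/[n/o]≡m/n m n g (gcd[m,n]∣n m n)))
    where
    [m/g]%[n/g]≢0 : (m / g) % (n / g) ≢ 0
    [m/g]%[n/g]≢0 eq = n∤m (subst₂ _∣_ (m/n*n≡m (gcd[m,n]∣n m n)) (m/n*n≡m (gcd[m,n]∣m m n))
                              (*-monoˡ-∣ g (m%n≡0⇒n∣m (m / g) (n / g) eq)))

0÷ℕ : ∀ Q → (+ 0) ÷ℕ Q ≡ 0ℚ
0÷ℕ zero    = refl
0÷ℕ (suc Q) = ℚ.0/n≡0 (suc Q)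

+[m+n]-+n≡+m : ∀ m n → + (m + n) - + n ≡ + m
+[m+n]-+n≡+m m n =
  trans (ℤ.m-n≡m⊖n (m + n) n) (trans (ℤ.⊖-≥ (ℕ.m≤n+m n m)) (cong +_ (ℕ.m+n∸n≡m m n)))

countWindow-complement : ∀ (p : ℕ → Bool) v ℓ → + countWindow (not ∘ p) v ℓ ≡ + ℓ - + countWindow p v ℓ
countWindow-complement p v ℓ = sym (trans (cong (λ m → + m - + countWindow p v ℓ) (sym total))
                                          (+[m+n]-+n≡+m (countWindow (not ∘ p) v ℓ) (countWindow p v ℓ)))
  where
  total : countWindow (not ∘ p) v ℓ + countWindow p v ℓ ≡ ℓ
  total = trans (countᵇ-not (λ i → p (v + i)) (upTo ℓ)) (length-upTo ℓ)

foldr-yFun : ∀ d w (S : ℕ → Bool) xs →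
             foldr (λ u acc → (if S u then yFun d w u else 0ℚ) ℚ.+ acc) 0ℚ xs
             ≡ (+ countᵇ (λ u → S u ∧ not (d ∣ᵇ u)) xs) ÷ℕ (w * (d ∸ 1))
foldr-yFun d w S [] = sym (0÷ℕ (w * (d ∸ 1)))
foldr-yFun d w S (x ∷ xs) with S x | d ∣ᵇ x
... | false | _     = trans (ℚ.+-identityˡ _) (foldr-yFun d w S xs)
... | true  | true  = trans (ℚ.+-identityˡ _) (foldr-yFun d w S xs)
... | true  | false = trans (cong ((+ 1) ÷ℕ (w * (d ∸ 1)) ℚ.+_) (foldr-yFun d w S xs))
                            (sym (÷ℕ-homo-+ 1 _ (w * (d ∸ 1))))

ySum-inSeg : ∀ d w r v ℓ → d ∣ r → ℓ ≤ r →
             ySum (suc r) (yFun d w) (inSeg r v ℓ) ≡ (+ countWindow (not ∘ (d ∣ᵇ_)) v ℓ) ÷ℕ (w * (d ∸ 1))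
ySum-inSeg d w r v ℓ d∣r ℓ≤r =
  trans (foldr-yFun d w (inSeg r v ℓ) (upTo (suc r))) (cong (λ c → (+ c) ÷ℕ (w * (d ∸ 1))) nonMultiples)
  where
  nonMultiples : countᵇ (λ u → inSeg r v ℓ u ∧ not (d ∣ᵇ u)) (upTo (suc r))
                 ≡ countWindow (not ∘ (d ∣ᵇ_)) v ℓ
  nonMultiples = trans (countᵇ-inSeg (not ∘ (d ∣ᵇ_)) r v ℓ ℓ≤r)
                       (countᵇ-cong (λ i → cong not (∣ᵇ-modℕ d r (v + i) d∣r)) (upTo ℓ))

countWindow-not-∣ᵇ : ∀ d .{{_ : NonZero d}} v ℓ →
  + countWindow (not ∘ (d ∣ᵇ_)) v ℓ ≡ + ℓ - floor (+ ℓ ℚ./ d)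
  ⊎ + countWindow (not ∘ (d ∣ᵇ_)) v ℓ ≡ + ℓ - ceiling (+ ℓ ℚ./ d)
countWindow-not-∣ᵇ d v ℓ = Sum.map
  (λ K≡ℓ/d → trans complement (cong (+ ℓ -_) (trans (cong +_ K≡ℓ/d) (sym (floor-/ ℓ d)))))
  (λ (d∤ℓ , K≡1+ℓ/d) →
     trans complement (cong (+ ℓ -_) (trans (cong +_ K≡1+ℓ/d) (sym (ceiling-/ ℓ d d∤ℓ)))))
  (countWindow-∣ᵇ d v ℓ)
  where
  complement : + countWindow (not ∘ (d ∣ᵇ_)) v ℓ ≡ + ℓ - + countWindow (d ∣ᵇ_) v ℓ
  complement = countWindow-complement (d ∣ᵇ_) v ℓ

ySum-inSeg-floor-ceiling : ∀ d w r v ℓ → 0 < d → d ∣ r → ℓ ≤ r →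
  ySum (suc r) (yFun d w) (inSeg r v ℓ) ≡ (+ ℓ - floor ((+ ℓ) ÷ℕ d)) ÷ℕ (w * (d ∸ 1))
  ⊎ ySum (suc r) (yFun d w) (inSeg r v ℓ) ≡ (+ ℓ - ceiling ((+ ℓ) ÷ℕ d)) ÷ℕ (w * (d ∸ 1))
ySum-inSeg-floor-ceiling d@(suc _) w r v ℓ _ d∣r ℓ≤r rewrite ySum-inSeg d w r v ℓ d∣r ℓ≤r =
  Sum.map (cong (_÷ℕ (w * (d ∸ 1)))) (cong (_÷ℕ (w * (d ∸ 1)))) (countWindow-not-∣ᵇ d v ℓ)

lemma3p2 : (k n : ℕ) → 2 ≤ k → 2 ^ k < n →
    let c = 2 ^ k ∸ 2
        d = gcd c (n ∸ 1)
        w = divℕ (n ∸ 1) d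
        y = yFun d w
    in 1 < d → (v ℓ : ℕ) → v < n → ℓ ≤ n ∸ 1 →
       (ySum n y (inSeg (n ∸ 1) v ℓ) ≡ ((+ ℓ) - floor ((+ ℓ) ÷ℕ d)) ÷ℕ (w * (d ∸ 1)))
       ⊎ (ySum n y (inSeg (n ∸ 1) v ℓ) ≡ ((+ ℓ) - ceiling ((+ ℓ) ÷ℕ d)) ÷ℕ (w * (d ∸ 1)))
lemma3p2 k zero    _ ()
lemma3p2 k (suc r) _ _ 1<d v ℓ _ ℓ≤r =
  ySum-inSeg-floor-ceiling d (divℕ r d) r v ℓ (ℕ.<⇒≤ 1<d) (gcd[m,n]∣n (2 ^ k ∸ 2) r) ℓ≤r
  where d = gcd (2 ^ k ∸ 2) r
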